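{- Let $p$ be an even positive integer and $\tau$ a non-negative integer. Let $\mu=\frac{p^2}{4}+2p+2$, $\gamma=2\mu-\left(\frac p2+4\right)$, $m=\mu+\tau\frac p2$, $g=\gamma+\tau(p-1)$, $c=p\mu+\tau\left(\frac{p^2}{2}-1\right)$, and $S(p,\tau)=\langle m,g,g+1\rangle_c$. Then the conductor of $S(p,\tau)$ is $c=p\mu+\tau\left(\frac{p^2}{2}-1\right)=pm-\tau$.
   Context: A numerical semigroup is a submonoid of $(\mathbb N,+)$ with finite complement. For integers $a_1,\dots,a_r$ and $t$, $\langle a_1,\dots,a_r\rangle_t$ denotes the smallest numerical semigroup containing $a_1,\dots,a_r$ and all integers $\ge t$. The conductor of a numerical semigroup $S$ is the smallest integer $c$ such that all integers $\ge c$ belong to $S$. -}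

module Defs where

open import Data.Nat using (ℕ; zero; suc; _+_; _*_; _∸_; _≤_)
open import Data.Nat.DivMod using (_/_)
open import Data.List using (List; []; _∷_)
open import Data.Product using (Σ; _×_)
open import Data.Sum using (_⊎_)
open import Relation.Binary.PropositionalEquality using (_≡_)

InMonoid : List ℕ → ℕ → Set
InMonoid []       n = n ≡ 0
InMonoid (a ∷ as) n = Σ ℕ λ k → Σ ℕ λ r → InMonoid as r × n ≡ k * a + r

-- ⟨ a₁,…,a_r ⟩_t : the smallest numerical semigroup containing the aᵢ and
-- all integers ≥ t.  Explicitly it is  ⟨a₁,…,a_r⟩ ∪ {n : n ≥ t}.
GenBelow : List ℕ → ℕ → ℕ → Set
GenBelow as t n = InMonoid as n ⊎ t ≤ n

IsConductor : (ℕ → Set) → ℕ → Set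
IsConductor S c =
  (∀ n → c ≤ n → S n) × (∀ c' → (∀ n → c' ≤ n → S n) → c ≤ c')

-- parameters of S(p,τ); p is assumed even and positive, so p / 2 is exact.
μ : ℕ → ℕ
μ p = (p / 2) * (p / 2) + 2 * p + 2

γ : ℕ → ℕ
γ p = 2 * μ p ∸ (p / 2 + 4)

mm : ℕ → ℕ → ℕ
mm p τ = μ p + τ * (p / 2)

gg : ℕ → ℕ → ℕ
gg p τ = γ p + τ * (p ∸ 1)

cc : ℕ → ℕ → ℕ
cc p τ = p * μ p + τ * ((p * p) / 2 ∸ 1)

S : ℕ → ℕ → ℕ → Set
S p τ = GenBelow (mm p τ ∷ gg p τ ∷ suc (gg p τ) ∷ []) (cc p τ)

-- Write h = p/2 and e = h + 4 + τ. The parameters satisfy g + e = 2m and h·e + 2 = m, so c − 1 = 2hm − (τ+1).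
-- If a·m + b·g + d·(g+1) = c − 1, put k = b + d and N = a + 2k; eliminating g gives
-- N·m + d + τ + 1 = 2h·m + k·e. For N < 2h the left side is too small, for N > 2h it is too large
-- (as k·e ≤ (N − 2h)·m), and for N = 2h the equation d + τ + 1 = k·e is impossible since d ≤ k and e ≥ τ + 3.
module Submission where

open import Data.Nat
open import Data.Nat.Properties
open import Data.Nat.Divisibility using (_∣_; divides)
open import Data.Nat.DivMod using (_/_; m*n/n≡m)
open import Data.Nat.Tactic.RingSolver using (solve)
open import Data.List using ([]; _∷_)
open import Data.Product using (_×_; _,_)
open import Data.Sum using (inj₁; inj₂)
open import Relation.Binary.PropositionalEquality
open import Relation.Binary using (tri<; tri≈; tri>)
open import Relation.Nullary using (¬_; yes; no; contradiction)

open import Defs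

GenBelow-isConductor : ∀ {as} t .{{_ : NonZero t}} → ¬ InMonoid as (pred t) →
                       IsConductor (GenBelow as t) t
GenBelow-isConductor {as} (suc c) c∉as = (λ _ → inj₂) , minimal
  where
  minimal : ∀ c' → (∀ n → c' ≤ n → GenBelow as (suc c) n) → suc c ≤ c'
  minimal c' all-from-c' with suc c ≤? c'
  ... | yes c<c' = c<c'
  ... | no  c≮c' with all-from-c' c (s≤s⁻¹ (≰⇒> c≮c'))
  ...   | inj₁ c∈as = contradiction c∈as c∉as
  ...   | inj₂ c<c  = contradiction c<c (n≮n c)

fewer-multiples-< : ∀ {N n M x y} → N < n → x < y + M → N * M + x < n * M + y
fewer-multiples-< {N} {n} {M} {x} {y} N<n x<y+M = begin-strict
  N * M + x        <⟨ +-monoʳ-< (N * M) x<y+M ⟩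
  N * M + (y + M)  ≡⟨ solve (N ∷ M ∷ y ∷ []) ⟩
  suc N * M + y    ≤⟨ +-monoˡ-≤ y (*-monoˡ-≤ M N<n) ⟩
  n * M + y        ∎
  where open ≤-Reasoning

half-≤ : ∀ {k x} → k + k ≤ x + suc x → k ≤ x
half-≤ {k} {x} 2k≤2x+1 with k ≤? x
... | yes k≤x = k≤x
... | no  k≰x = contradiction (≤-trans (+-mono-≤ x<k x<k) 2k≤2x+1) (n≮n (x + suc x))
  where x<k = ≰⇒> k≰x

offset-≢-multiple : ∀ {d k T e} → d ≤ k → 3 + T ≤ e → d + suc T ≢ k * e
offset-≢-multiple {k = zero}  z≤n _ ()
offset-≢-multiple {d} {suc k} {T} {e} d≤k 3+T≤e = <⇒≢ (begin-strict
  d + suc T        ≤⟨ +-monoˡ-≤ (suc T) d≤k ⟩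
  suc k + suc T    ≡⟨ solve (k ∷ T ∷ []) ⟩
  suc (suc T) + k  <⟨ +-monoˡ-< k (n<1+n (suc (suc T))) ⟩
  3 + T + k        ≤⟨ +-mono-≤ 3+T≤e (m≤m*n k e ⦃ >-nonZero (≤-trans (s≤s z≤n) 3+T≤e) ⦄) ⟩
  e + k * e        ∎)
  where open ≤-Reasoning

excess-bound : ∀ {q e M k j} → q * e ≤ M → e ≤ M → k + k ≤ suc (q * 2) + j → k * e ≤ suc j * M
excess-bound {q} {e} {M} {k} {j} qe≤M e≤M 2k≤N = begin
  k * e          ≤⟨ *-monoˡ-≤ e (half-≤ {k} 2k≤2[q+j]+1) ⟩
  (q + j) * e    ≡⟨ *-distribʳ-+ e q j ⟩
  q * e + j * e  ≤⟨ +-mono-≤ qe≤M (*-monoʳ-≤ j e≤M) ⟩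
  suc j * M      ∎
  where
  open ≤-Reasoning
  2k≤2[q+j]+1 : k + k ≤ (q + j) + suc (q + j)
  2k≤2[q+j]+1 = begin
    k + k                    ≤⟨ 2k≤N ⟩
    suc (q * 2) + j          ≤⟨ m≤m+n (suc (q * 2) + j) j ⟩
    suc (q * 2) + j + j      ≡⟨ solve (q ∷ j ∷ []) ⟩
    (q + j) + suc (q + j)    ∎

balance-impossible : ∀ {q M e T N k d} → q * e ≤ M → e ≤ M → 3 + T ≤ e → k + k ≤ N → d ≤ k →
                     N * M + (d + suc T) ≢ q * 2 * M + k * e
balance-impossible {q} {M} {e} {T} {N} {k} {d} qe≤M e≤M 3+T≤e 2k≤N d≤k balance with <-cmp N (q * 2)
... | tri< N<2q _ _ = <⇒≢ (fewer-multiples-< N<2q (+-mono-≤-< d≤ke 1+T<M)) balance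
  where
  d≤ke : d ≤ k * e
  d≤ke = ≤-trans d≤k (m≤m*n k e ⦃ >-nonZero (≤-trans (s≤s z≤n) 3+T≤e) ⦄)
  1+T<M : suc T < M
  1+T<M = ≤-trans (≤-trans (n≤1+n (2 + T)) 3+T≤e) e≤M
... | tri≈ _ refl _ = offset-≢-multiple d≤k 3+T≤e (+-cancelˡ-≡ (q * 2 * M) _ _ balance)
... | tri> _ _ 2q<N with m≤n⇒∃[o]m+o≡n 2q<N
...   | j , refl = <⇒≢ (begin-strict
  q * 2 * M + k * e              ≤⟨ +-monoʳ-≤ (q * 2 * M) (excess-bound {q} {k = k} {j} qe≤M e≤M 2k≤N) ⟩
  q * 2 * M + suc j * M          ≡⟨ solve (q ∷ j ∷ M ∷ []) ⟩
  (suc (q * 2) + j) * M          <⟨ m<m+n _ (≤-trans (s≤s z≤n) (m≤n+m (suc T) d)) ⟩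
  (suc (q * 2) + j) * M + (d + suc T) ∎) (sym balance)
  where open ≤-Reasoning

gap-below-2qM : ∀ {q M G e T n} .{{_ : NonZero q}} → q * e ≤ M → 3 + T ≤ e → G + e ≡ M + M →
                n + suc T ≡ q * 2 * M → ¬ InMonoid (M ∷ G ∷ suc G ∷ []) n
gap-below-2qM {q} {M} {G} {e} {T} qe≤M 3+T≤e G+e≡2M n+1+T≡2qM
  (a , _ , (b , _ , (d , _ , refl , refl) , refl) , refl) =
  balance-impossible {q} {k = b + d} qe≤M (≤-trans (m≤n*m e q) qe≤M) 3+T≤e
                     (m≤n+m ((b + d) + (b + d)) a) (m≤n+m d b) balance
  where
  balance : (a + ((b + d) + (b + d))) * M + (d + suc T) ≡ q * 2 * M + (b + d) * e
  balance = begin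
    (a + ((b + d) + (b + d))) * M + (d + suc T)             ≡⟨ solve (a ∷ b ∷ d ∷ M ∷ T ∷ []) ⟩
    a * M + (b + d) * (M + M) + (d + suc T)                 ≡⟨ cong (λ z → a * M + (b + d) * z + (d + suc T)) (sym G+e≡2M) ⟩
    a * M + (b + d) * (G + e) + (d + suc T)                 ≡⟨ solve (a ∷ b ∷ d ∷ M ∷ G ∷ e ∷ T ∷ []) ⟩
    a * M + (b * G + (d * suc G + 0)) + suc T + (b + d) * e ≡⟨ cong (_+ (b + d) * e) n+1+T≡2qM ⟩
    q * 2 * M + (b + d) * e                                 ∎
    where open ≡-Reasoning

μ-double : ∀ h → μ (h * 2) ≡ h * h + 4 * h + 2
μ-double h = begin
  (h * 2 / 2) * (h * 2 / 2) + 2 * (h * 2) + 2  ≡⟨ cong (λ x → x * x + 2 * (h * 2) + 2) (m*n/n≡m h 2) ⟩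
  h * h + 2 * (h * 2) + 2                      ≡⟨ solve (h ∷ []) ⟩
  h * h + 4 * h + 2                            ∎
  where open ≡-Reasoning

γ-double : ∀ h → γ (h * 2) ≡ 2 * (h * h) + 7 * h
γ-double h = begin
  2 * μ (h * 2) ∸ (h * 2 / 2 + 4)               ≡⟨ cong₂ (λ x y → 2 * x ∸ (y + 4)) (μ-double h) (m*n/n≡m h 2) ⟩
  2 * (h * h + 4 * h + 2) ∸ (h + 4)             ≡⟨ cong (_∸ (h + 4)) (solve (h ∷ [])) ⟩
  (h + 4) + (2 * (h * h) + 7 * h) ∸ (h + 4)     ≡⟨ m+n∸m≡n (h + 4) _ ⟩
  2 * (h * h) + 7 * h                           ∎
  where open ≡-Reasoning

mm-double : ∀ h τ → mm (h * 2) τ ≡ h * (h + 4 + τ) + 2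
mm-double h τ = begin
  μ (h * 2) + τ * (h * 2 / 2)  ≡⟨ cong₂ (λ x y → x + τ * y) (μ-double h) (m*n/n≡m h 2) ⟩
  h * h + 4 * h + 2 + τ * h    ≡⟨ solve (h ∷ τ ∷ []) ⟩
  h * (h + 4 + τ) + 2          ∎
  where open ≡-Reasoning

-- With h = suc r, the truncated subtractions p ∸ 1 and p²/2 ∸ 1 compute to suc (r * 2) and
-- suc ((r + r * suc r) * 2); they are written in that form because the ring solver cannot see through ∸.
gg-double : ∀ r τ → gg (suc r * 2) τ + (suc r + 4 + τ) ≡ mm (suc r * 2) τ + mm (suc r * 2) τ
gg-double r τ = begin
  γ (suc r * 2) + τ * suc (r * 2) + (suc r + 4 + τ)       ≡⟨ cong (λ x → x + τ * suc (r * 2) + (suc r + 4 + τ)) (γ-double (suc r)) ⟩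
  2 * (suc r * suc r) + 7 * suc r + τ * suc (r * 2) + (suc r + 4 + τ)
                                                          ≡⟨ solve (r ∷ τ ∷ []) ⟩
  (suc r * (suc r + 4 + τ) + 2) + (suc r * (suc r + 4 + τ) + 2)
                                                          ≡⟨ sym (cong₂ _+_ (mm-double (suc r) τ) (mm-double (suc r) τ)) ⟩
  mm (suc r * 2) τ + mm (suc r * 2) τ                     ∎
  where open ≡-Reasoning

half-square-double : ∀ h → h * 2 * (h * 2) / 2 ≡ h * h * 2
half-square-double h = begin
  h * 2 * (h * 2) / 2  ≡⟨ cong (_/ 2) square-double ⟩
  h * h * 2 * 2 / 2    ≡⟨ m*n/n≡m (h * h * 2) 2 ⟩
  h * h * 2            ∎
  where
  open ≡-Reasoning
  square-double : h * 2 * (h * 2) ≡ h * h * 2 * 2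
  square-double = solve (h ∷ [])

cc-double : ∀ r τ → cc (suc r * 2) τ + τ ≡ suc r * 2 * mm (suc r * 2) τ
cc-double r τ = begin
  suc r * 2 * μ (suc r * 2) + τ * (suc r * 2 * (suc r * 2) / 2 ∸ 1) + τ
    ≡⟨ cong₂ (λ x y → suc r * 2 * x + τ * (y ∸ 1) + τ) (μ-double (suc r)) (half-square-double (suc r)) ⟩
  suc r * 2 * (suc r * suc r + 4 * suc r + 2) + τ * suc ((r + r * suc r) * 2) + τ
    ≡⟨ solve (r ∷ τ ∷ []) ⟩
  suc r * 2 * (suc r * (suc r + 4 + τ) + 2)
    ≡⟨ cong (suc r * 2 *_) (sym (mm-double (suc r) τ)) ⟩
  suc r * 2 * mm (suc r * 2) τ
    ∎
  where open ≡-Reasoning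

cc-positive : ∀ p τ .{{_ : NonZero p}} → 0 < cc p τ
cc-positive p τ = begin-strict
  0            <⟨ s≤s z≤n ⟩
  2            ≤⟨ m≤n+m 2 _ ⟩
  μ p          ≤⟨ m≤n*m (μ p) p ⟩
  p * μ p      ≤⟨ m≤m+n (p * μ p) _ ⟩
  cc p τ       ∎
  where open ≤-Reasoning

proposition4p1 : (p τ : ℕ) → 0 < p → 2 ∣ p →
    IsConductor (S p τ) (cc p τ) × cc p τ ≡ p * mm p τ ∸ τ
proposition4p1 .(suc r * 2) τ _ (divides (suc r) refl) =
  GenBelow-isConductor (cc p τ) c-1∉S , cc≡pm∸τ
  where
  h = suc r
  p = h * 2
  e = h + 4 + τ
  instance
    cc-nonZero : NonZero (cc p τ)
    cc-nonZero = >-nonZero (cc-positive p τ)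
  he≤m : h * e ≤ mm p τ
  he≤m = ≤-trans (m≤m+n (h * e) 2) (≤-reflexive (sym (mm-double h τ)))
  3+τ≤e : 3 + τ ≤ e
  3+τ≤e = +-monoˡ-≤ τ (≤-trans (n≤1+n 3) (m≤n+m 4 h))
  c-1+1+τ≡pm : pred (cc p τ) + suc τ ≡ p * mm p τ
  c-1+1+τ≡pm = trans (+-suc (pred (cc p τ)) τ) (trans (cong (_+ τ) (suc-pred (cc p τ))) (cc-double r τ))
  c-1∉S : ¬ InMonoid (mm p τ ∷ gg p τ ∷ suc (gg p τ) ∷ []) (pred (cc p τ))
  c-1∉S = gap-below-2qM {h} he≤m 3+τ≤e (gg-double r τ) c-1+1+τ≡pm
  cc≡pm∸τ : cc p τ ≡ p * mm p τ ∸ τ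
  cc≡pm∸τ = trans (sym (m+n∸n≡m (cc p τ) τ)) (cong (_∸ τ) (cc-double r τ))
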